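{- For any integers $a\ge b\ge 1$ and any $p\ge 3$, there exists a cactus $G$ of girth $p$ such that $\mathsf{sep}(G,a,b)=\mathsf{fsep}(G,a,b)$.
   Context: All graphs are finite and simple. A cactus is a connected graph in which every edge belongs to at most one cycle; the girth is the length of a shortest cycle. For integers $a\ge b\ge 1$ and $c\ge 0$: an $a$-list assignment of a graph $G$ is a function $L$ assigning to each vertex $v$ a set $L(v)$ of exactly $a$ integers (colors). It is $c$-separating if $|L(u)\cap L(v)|\le c$ for every edge $uv$. An $(L,b)$-coloring of $G$ is a function $\varphi$ assigning to each vertex $v$ a set $\varphi(v)\subseteq L(v)$ with $|\varphi(v)|=b$ such that $\varphi(u)\cap\varphi(v)=\emptyset$ for every edge $uv$. $G$ is $(a,b,c)$-choosable if for every $c$-separating $a$-list assignment $L$ of $G$ there is an $(L,b)$-coloring. $G$ is $(a,b,c)$-free-choosable if for every $c$-separating $a$-list assignment $L$ of $G$, every vertex $v$ and every $C\subseteq L(v)$ with $|C|=b$, there exists an $(L,b)$-coloring $\varphi$ of $G$ with $\varphi(v)=C$. $\mathsf{sep}(G,a,b)=\max\{c\ge 0: G\text{ is }(a,b,c)\text{ -choosable}\}$ and $\mathsf{fsep}(G,a,b)=\max\{c\ge 0: G\text{ is }(a,b,c)\text{ -free-choosable}\}$. -}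

module Defs where

open import Data.Nat using (ℕ; zero; suc; _≤_)
open import Data.Fin using (Fin; zero; suc; inject₁; fromℕ)
open import Data.Integer using (ℤ) renaming (_≟_ to _≟ℤ_)
open import Data.List using (List; length; filter)
open import Data.List.Membership.Propositional using (_∈_)
open import Data.List.Membership.DecPropositional _≟ℤ_ using (_∈?_)
open import Data.List.Relation.Unary.Unique.Propositional using (Unique)
open import Data.Maybe using (Maybe; just; nothing)
open import Data.Product using (Σ; ∃; _×_; _,_)
open import Data.Sum using (_⊎_)
open import Data.Empty using (⊥)
open import Function.Definitions using (Injective)
open import Relation.Binary.PropositionalEquality using (_≡_)

record Graph : Set₁ where
  field
    n     : ℕ
    Adj   : Fin n → Fin n → Set
    sym   : ∀ {u v} → Adj u v → Adj v u
    irrefl : ∀ {v} → Adj v v → ⊥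
open Graph public

data Reach (G : Graph) : Fin (n G) → Fin (n G) → Set where
  here : ∀ {v} → Reach G v v
  step : ∀ {u w v} → Adj G u w → Reach G w v → Reach G u v

Connected : Graph → Set
Connected G = ∀ u v → Reach G u v

record Cycle (G : Graph) : Set where
  field
    m      : ℕ
    long   : 2 ≤ m
    vert   : Fin (suc m) → Fin (n G)
    inj    : Injective _≡_ _≡_ vert
    adj    : ∀ (i : Fin m) → Adj G (vert (inject₁ i)) (vert (suc i))
    close  : Adj G (vert (fromℕ m)) (vert zero)
open Cycle public

cycleLength : ∀ {G} → Cycle G → ℕ
cycleLength C = suc (m C)

Consec : ∀ {G} → Cycle G → Fin (n G) → Fin (n G) → Set
Consec C x y =
  (∃ λ (i : Fin (m C)) → (x ≡ vert C (inject₁ i)) × (y ≡ vert C (suc i)))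
  ⊎ ((x ≡ vert C (fromℕ (m C))) × (y ≡ vert C zero))

CycleEdge : ∀ {G} → Cycle G → Fin (n G) → Fin (n G) → Set
CycleEdge C x y = Consec C x y ⊎ Consec C y x

-- two cycles are the same subgraph iff they have the same edge set
SameCycle : ∀ {G} → Cycle G → Cycle G → Set
SameCycle {G} C D = ∀ (x y : Fin (n G)) →
  (CycleEdge C x y → CycleEdge D x y) × (CycleEdge D x y → CycleEdge C x y)

Cactus : Graph → Set
Cactus G = Connected G ×
  (∀ (C D : Cycle G) (x y : Fin (n G)) → Adj G x y →
     CycleEdge C x y → CycleEdge D x y → SameCycle C D)

Girth : Graph → ℕ → Set
Girth G p = (∃ λ (C : Cycle G) → cycleLength C ≡ p) ×
            (∀ (C : Cycle G) → p ≤ cycleLength C)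

-- List assignments and colorings (colors are integers; a finite set of
-- integers is a duplicate-free list)

_⊆_ : List ℤ → List ℤ → Set
xs ⊆ ys = ∀ x → x ∈ xs → x ∈ ys

interSize : List ℤ → List ℤ → ℕ
interSize xs ys = length (filter (λ x → x ∈? ys) xs)

ListAssignment : (G : Graph) → ℕ → (Fin (n G) → List ℤ) → Set
ListAssignment G a L = ∀ v → Unique (L v) × length (L v) ≡ a

Separating : (G : Graph) → ℕ → (Fin (n G) → List ℤ) → Set
Separating G c L = ∀ u v → Adj G u v → interSize (L u) (L v) ≤ c

IsColoring : (G : Graph) → (Fin (n G) → List ℤ) → ℕ → (Fin (n G) → List ℤ) → Set
IsColoring G L b φ =
  (∀ v → Unique (φ v) × length (φ v) ≡ b × φ v ⊆ L v) ×
  (∀ u v → Adj G u v → ∀ x → x ∈ φ u → x ∈ φ v → ⊥)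

Choosable : Graph → ℕ → ℕ → ℕ → Set
Choosable G a b c = ∀ (L : Fin (n G) → List ℤ) →
  ListAssignment G a L → Separating G c L →
  ∃ λ φ → IsColoring G L b φ

FreeChoosable : Graph → ℕ → ℕ → ℕ → Set
FreeChoosable G a b c = ∀ (L : Fin (n G) → List ℤ) →
  ListAssignment G a L → Separating G c L →
  ∀ (v : Fin (n G)) (C : List ℤ) → Unique C → length C ≡ b → C ⊆ L v →
  ∃ λ φ → IsColoring G L b φ × (φ v ⊆ C × C ⊆ φ v)

-- max{ c ≥ 0 : P c } as an element of ℕ ∪ {∞}: 'just s' means the
-- maximum exists and equals s; 'nothing' means P c holds for every c (∞).

IsMax : (ℕ → Set) → Maybe ℕ → Set
IsMax P (just s) = P s × (∀ c → P c → c ≤ s)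
IsMax P nothing  = ∀ c → P c

-- The witness is a flower: cycles of length p sharing one vertex, the root; it is a cactus of
-- girth p. Choosability and free choosability of the flower, for a given separation c, both
-- turn out to be equivalent to free choosability of the cycle C_p at a vertex. Free extensions
-- from the root can be glued petal by petal, and C_p is vertex-transitive. Conversely, if some
-- c-separating assignment of C_p has a precolouring of the root that does not extend, copy it
-- onto one petal for each ordering of the root list, renamed along that ordering: whatever b
-- colours the root receives, some petal sees exactly the bad precolouring, so the flower is not
-- even choosable. Finally, free choosability of C_p at a vertex is decidable, since every
-- instance can be injectively recoloured into a fixed finite palette; hence the maxima defining
-- sep and fsep exist, and they coincide.

module Submission where

open import Data.Nat as ℕ using (ℕ; zero; suc; z≤n; s≤s; _≤_; _<_; _*_)
import Data.Nat.Properties as ℕ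
open import Data.Fin as Fin using (Fin; zero; suc; inject₁; fromℕ; toℕ; fromℕ<)
import Data.Fin.Properties as Fin
open import Data.Fin.Relation.Unary.Top using (view; ‵fromℕ; ‵inj₁; view-fromℕ; view-inject₁)
open import Data.Fin.Induction using (<-weakInduction)
open import Data.Empty using (⊥; ⊥-elim)
open import Data.Unit using (⊤; tt)
open import Data.Integer.Properties using (+-injective)
open import Relation.Binary.PropositionalEquality
open import Relation.Nullary using (¬_; Dec; yes; no; ¬?; _×-dec_; _→-dec_; _⊎-dec_)
open import Relation.Nullary.Decidable using (map′)
open import Data.Integer using (ℤ; +_; ∣_∣) renaming (_≟_ to _≟ℤ_)
open import Data.List
  using (List; []; _∷_; length; filter; map; _++_; applyUpTo; deduplicate; concatMap; take; lookup)
open import Data.List.Properties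
  using (length-filter; filter-notAll; filter-≐; length-map; length-applyUpTo; length-take; length-++)
open import Data.List.Membership.Propositional using (_∈_; _∉_; find)
open import Data.List.Membership.Propositional.Properties
  using (∈-filter⁺; ∈-filter⁻; ∈-map⁺; ∈-map⁻; ∈-++⁺ˡ; ∈-++⁺ʳ; ∈-++⁻; ∈-deduplicate⁺; ∈-deduplicate⁻;
         ∈-applyUpTo⁺; ∈-concat⁺′; ∈-concat⁻′; ∈-lookup)
open import Data.List.Membership.Propositional.Properties.WithK using (unique∧set⇒bag)
open import Data.List.Membership.DecPropositional _≟ℤ_ using (_∈?_)
open import Data.List.Relation.Unary.Any using (Any; here; there)
import Data.List.Relation.Unary.Any as Any
open import Data.List.Relation.Unary.Any.Properties using (lookup-index)
open import Data.List.Relation.Unary.All using (All; []; _∷_)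
import Data.List.Relation.Unary.All as All
import Data.List.Relation.Unary.All.Properties as All
open import Data.List.Relation.Unary.All.Properties using (¬All⇒Any¬)
open import Data.List.Relation.Unary.AllPairs using ([]; _∷_)
open import Data.List.Relation.Unary.Unique.Propositional using (Unique)
import Data.List.Relation.Unary.Unique.Propositional.Properties as Unique
open import Data.List.Relation.Unary.Unique.DecPropositional.Properties _≟ℤ_ using (deduplicate-!)
open import Data.List.Relation.Unary.Unique.DecPropositional _≟ℤ_ using (unique?)
import Data.List.Relation.Binary.Subset.DecPropositional _≟ℤ_ as Subset
open import Data.List.Relation.Binary.BagAndSetEquality using (∼bag⇒↭)
open import Data.List.Relation.Binary.Permutation.Propositional using (_↭_)
open import Data.List.Relation.Binary.Permutation.Propositional.Properties using (↭-length; filter-↭)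
open import Data.Product using (∃; ∃₂; _×_; _,_; proj₁; proj₂)
open import Data.Maybe using (Maybe; just; nothing)
open import Data.Sum using (_⊎_; inj₁; inj₂)
open import Function.Bundles using (mk⇔)
open import Function.Base using (_∘_; case_of_)
open import Defs hiding (sym)

-- Finite sets of colours as duplicate-free lists

variable
  x : ℤ
  xs ys zs xs′ ys′ : List ℤ
  k : ℕ

infix 4 _≐_
_≐_ : List ℤ → List ℤ → Set
xs ≐ ys = xs ⊆ ys × ys ⊆ xs

⊆-refl : xs ⊆ xs
⊆-refl _ x∈xs = x∈xs

⊆-trans : xs ⊆ ys → ys ⊆ zs → xs ⊆ zs
⊆-trans xs⊆ys ys⊆zs x x∈xs = ys⊆zs x (xs⊆ys x x∈xs)

≐-refl : xs ≐ xs
≐-refl = ⊆-refl , ⊆-refl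

≐-sym : xs ≐ ys → ys ≐ xs
≐-sym (xs⊆ys , ys⊆xs) = ys⊆xs , xs⊆ys

≐-trans : xs ≐ ys → ys ≐ zs → xs ≐ zs
≐-trans (p , q) (p′ , q′) = ⊆-trans p p′ , ⊆-trans q′ q

map-≐ : ∀ (f : ℤ → ℤ) → xs ≐ ys → map f xs ≐ map f ys
map-≐ f (xs⊆ys , ys⊆xs) = map-⊆ xs⊆ys , map-⊆ ys⊆xs
  where
  map-⊆ : ∀ {xs ys} → xs ⊆ ys → map f xs ⊆ map f ys
  map-⊆ xs⊆ys y y∈ with ∈-map⁻ f y∈
  ... | x , x∈xs , refl = ∈-map⁺ f (xs⊆ys x x∈xs)

interSize-≤ : ∀ xs ys → interSize xs ys ≤ length xs
interSize-≤ xs ys = length-filter (_∈? ys) xs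

interSize-≐ : Unique xs → Unique xs′ → xs ≐ xs′ → ys ≐ ys′ →
              interSize xs ys ≡ interSize xs′ ys′
interSize-≐ {xs} {xs′} {ys} {ys′} u u′ (p , q) (p′ , q′) = begin
  length (filter (_∈? ys) xs)   ≡⟨ ↭-length (filter-↭ (_∈? ys) xs↭xs′) ⟩
  length (filter (_∈? ys) xs′)  ≡⟨ cong length (filter-≐ (_∈? ys) (_∈? ys′) ((λ {x} → p′ x) , (λ {x} → q′ x)) xs′) ⟩
  length (filter (_∈? ys′) xs′) ∎
  where
  open ≡-Reasoning
  xs↭xs′ : xs ↭ xs′
  xs↭xs′ = ∼bag⇒↭ (unique∧set⇒bag u u′ (λ {x} → mk⇔ (p x) (q x)))

interSize≤0⇒disjoint : interSize xs ys ≤ 0 → x ∈ xs → x ∈ ys → ⊥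
interSize≤0⇒disjoint {xs} {ys} ≤0 x∈xs x∈ys with filter (_∈? ys) xs | ∈-filter⁺ (_∈? ys) x∈xs x∈ys
interSize≤0⇒disjoint () _ _ | _ ∷ _ | _

Unique-⊆⇒length-≤ : Unique xs → xs ⊆ ys → length xs ≤ length ys
Unique-⊆⇒length-≤ {[]} _ _ = z≤n
Unique-⊆⇒length-≤ {x ∷ xs} {ys} (x∉xs ∷ u) x∷xs⊆ys = begin-strict
  length xs                   ≤⟨ Unique-⊆⇒length-≤ u xs⊆ys-x ⟩
  length (filter ≢x? ys)      <⟨ filter-notAll ≢x? ys (Any.map (λ { refl x≢x → x≢x refl }) (x∷xs⊆ys x (here refl))) ⟩
  length ys                   ∎
  where
  open ℕ.≤-Reasoning
  ≢x? : ∀ y → Dec (¬ y ≡ x)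
  ≢x? y = ¬? (y ≟ℤ x)
  xs⊆ys-x : xs ⊆ filter ≢x? ys
  xs⊆ys-x y y∈xs = ∈-filter⁺ ≢x? (x∷xs⊆ys y (there y∈xs)) (λ { refl → All.lookup x∉xs y∈xs refl })

Unique-⊆-length-≤⇒⊇ : Unique xs → Unique ys → xs ⊆ ys → length ys ≤ length xs → ys ⊆ xs
Unique-⊆-length-≤⇒⊇ {xs} {ys} u _ xs⊆ys ∣ys∣≤∣xs∣ y y∈ys with y ∈? xs
... | yes y∈xs = y∈xs
... | no y∉xs = ⊥-elim (ℕ.<⇒≱ (Unique-⊆⇒length-≤ (y∉xs′ ∷ u) y∷xs⊆ys) ∣ys∣≤∣xs∣)
  where
  y∉xs′ : All (y ≢_) xs
  y∉xs′ = All.tabulate λ { z∈xs refl → y∉xs z∈xs }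
  y∷xs⊆ys : (y ∷ xs) ⊆ ys
  y∷xs⊆ys _ (here refl) = y∈ys
  y∷xs⊆ys z (there z∈xs) = xs⊆ys z z∈xs

extend : List ℤ → List ℤ → List ℤ
extend xs ys = xs ++ filter (λ y → ¬? (y ∈? xs)) (deduplicate _≟ℤ_ ys)

extend-unique : ∀ ys → Unique xs → Unique (extend xs ys)
extend-unique {xs} ys u =
  Unique.++⁺ u (Unique.filter⁺ (λ y → ¬? (y ∈? xs)) {deduplicate _≟ℤ_ ys} (deduplicate-! ys))
  λ (x∈xs , x∈rest) → proj₂ (∈-filter⁻ (λ y → ¬? (y ∈? xs)) {xs = deduplicate _≟ℤ_ ys} x∈rest) x∈xs

⊆-extendˡ : ∀ ys → xs ⊆ extend xs ys
⊆-extendˡ _ _ = ∈-++⁺ˡ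

⊆-extendʳ : ∀ xs → ys ⊆ extend xs ys
⊆-extendʳ {ys} xs y y∈ys with y ∈? xs
... | yes y∈xs = ∈-++⁺ˡ y∈xs
... | no y∉xs = ∈-++⁺ʳ xs (∈-filter⁺ (λ y → ¬? (y ∈? xs)) (∈-deduplicate⁺ _≟ℤ_ y∈ys) y∉xs)

extend-⊆ : xs ⊆ zs → ys ⊆ zs → extend xs ys ⊆ zs
extend-⊆ {xs} {zs} {ys} xs⊆zs ys⊆zs x x∈ext with ∈-++⁻ xs x∈ext
... | inj₁ x∈xs = xs⊆zs x x∈xs
... | inj₂ x∈rest = ys⊆zs x (∈-deduplicate⁻ _≟ℤ_ ys (proj₁ (∈-filter⁻ (λ y → ¬? (y ∈? xs)) x∈rest)))

indexOf : ℤ → List ℤ → ℕ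
indexOf x [] = 0
indexOf x (y ∷ ys) with x ≟ℤ y
... | yes _ = 0
... | no _ = suc (indexOf x ys)

-- beyond the end of the list, nth returns the junk value + 0
nth : List ℤ → ℕ → ℤ
nth [] _ = + 0
nth (y ∷ ys) zero = y
nth (y ∷ ys) (suc k) = nth ys k

nth-indexOf : x ∈ ys → nth ys (indexOf x ys) ≡ x
nth-indexOf {x} {y ∷ ys} x∈y∷ys with x ≟ℤ y | x∈y∷ys
... | yes x≡y | _ = sym x≡y
... | no x≢y | here x≡y = ⊥-elim (x≢y x≡y)
... | no _ | there x∈ys = nth-indexOf x∈ys

indexOf-< : x ∈ ys → indexOf x ys < length ys
indexOf-< {x} {y ∷ ys} x∈y∷ys with x ≟ℤ y | x∈y∷ys
... | yes _ | _ = s≤s z≤n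
... | no x≢y | here x≡y = ⊥-elim (x≢y x≡y)
... | no _ | there x∈ys = s≤s (indexOf-< x∈ys)

indexOf-++ˡ : x ∈ xs → indexOf x (xs ++ ys) ≡ indexOf x xs
indexOf-++ˡ {x} {y ∷ xs} x∈y∷xs with x ≟ℤ y | x∈y∷xs
... | yes _ | _ = refl
... | no x≢y | here x≡y = ⊥-elim (x≢y x≡y)
... | no _ | there x∈xs = cong suc (indexOf-++ˡ x∈xs)

nth-∈ : k < length ys → nth ys k ∈ ys
nth-∈ {zero} {y ∷ ys} _ = here refl
nth-∈ {suc k} {y ∷ ys} (s≤s k<∣ys∣) = there (nth-∈ k<∣ys∣)

indexOf-nth : Unique ys → k < length ys → indexOf (nth ys k) ys ≡ k
indexOf-nth {y ∷ ys} {zero} _ _ with y ≟ℤ y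
... | yes _ = refl
... | no y≢y = ⊥-elim (y≢y refl)
indexOf-nth {y ∷ ys} {suc k} (y∉ys ∷ u) (s≤s k<∣ys∣) with nth ys k ≟ℤ y
... | yes nth≡y = ⊥-elim (All.lookup y∉ys (nth-∈ k<∣ys∣) (sym nth≡y))
... | no _ = cong suc (indexOf-nth u k<∣ys∣)

palette : ℕ → List ℤ
palette = applyUpTo +_

palette-unique : ∀ k → Unique (palette k)
palette-unique k = Unique.applyUpTo⁺₁ +_ k (λ i<j _ → ℕ.<⇒≢ i<j ∘ +-injective)

length-palette : ∀ k → length (palette k) ≡ k
length-palette = length-applyUpTo +_

∈-palette⁺ : ∀ {j} → j < k → + j ∈ palette k
∈-palette⁺ = ∈-applyUpTo⁺ +_

nth-applyUpTo : ∀ (f : ℕ → ℤ) {j k} → j < k → nth (applyUpTo f k) j ≡ f j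
nth-applyUpTo f {zero} {suc k} _ = refl
nth-applyUpTo f {suc j} {suc k} (s≤s j<k) = nth-applyUpTo (f ∘ suc) j<k

nth-palette : ∀ {j} → j < k → nth (palette k) j ≡ + j
nth-palette = nth-applyUpTo +_

reindex : List ℤ → List ℤ → ℤ → ℤ
reindex xs ys x with x ∈? xs
... | yes _ = nth ys (indexOf x xs)
... | no _ = x

reindex-∈ : x ∈ xs → reindex xs ys x ≡ nth ys (indexOf x xs)
reindex-∈ {x} {xs} x∈xs with x ∈? xs
... | yes _ = refl
... | no x∉xs = ⊥-elim (x∉xs x∈xs)

reindex-∉ : x ∉ xs → reindex xs ys x ≡ x
reindex-∉ {x} {xs} x∉xs with x ∈? xs
... | yes x∈xs = ⊥-elim (x∉xs x∈xs)
... | no _ = refl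

reindex-inverse : Unique ys → length xs ≡ length ys → xs ≐ ys →
                  ∀ x → reindex ys xs (reindex xs ys x) ≡ x
reindex-inverse {ys} {xs} u ∣xs∣≡∣ys∣ (xs⊆ys , ys⊆xs) x with x ∈? xs
... | no x∉xs = reindex-∉ (x∉xs ∘ ys⊆xs x)
... | yes x∈xs = begin
  reindex ys xs (nth ys i)        ≡⟨ reindex-∈ {xs = ys} {ys = xs} (nth-∈ i<∣ys∣) ⟩
  nth xs (indexOf (nth ys i) ys)  ≡⟨ cong (nth xs) (indexOf-nth u i<∣ys∣) ⟩
  nth xs i                        ≡⟨ nth-indexOf x∈xs ⟩
  x                               ∎
  where
  open ≡-Reasoning
  i : ℕ
  i = indexOf x xs
  i<∣ys∣ : i < length ys
  i<∣ys∣ = subst (i <_) ∣xs∣≡∣ys∣ (indexOf-< x∈xs)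

map-reindex : Unique xs → length xs ≡ length ys → map (reindex xs ys) xs ≐ ys
map-reindex {xs} {ys} u ∣xs∣≡∣ys∣ = ⊆ys , ys⊆
  where
  ⊆ys : map (reindex xs ys) xs ⊆ ys
  ⊆ys y y∈ with ∈-map⁻ (reindex xs ys) y∈
  ... | x , x∈xs , refl = subst (_∈ ys) (sym (reindex-∈ {ys = ys} x∈xs))
                            (nth-∈ (subst (indexOf x xs <_) ∣xs∣≡∣ys∣ (indexOf-< x∈xs)))
  ys⊆ : ys ⊆ map (reindex xs ys) xs
  ys⊆ y y∈ys = subst (_∈ map (reindex xs ys) xs) fnth≡y (∈-map⁺ (reindex xs ys) (nth-∈ i<∣xs∣))
    where
    i : ℕ
    i = indexOf y ys
    i<∣xs∣ : i < length xs
    i<∣xs∣ = subst (i <_) (sym ∣xs∣≡∣ys∣) (indexOf-< y∈ys)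
    fnth≡y : reindex xs ys (nth xs i) ≡ y
    fnth≡y = trans (reindex-∈ {xs = xs} {ys = ys} (nth-∈ i<∣xs∣))
                   (trans (cong (nth ys) (indexOf-nth u i<∣xs∣)) (nth-indexOf y∈ys))

Unique-map⁺-on : ∀ {P : ℤ → Set} {h : ℤ → ℤ} → (∀ {x y} → P x → P y → h x ≡ h y → x ≡ y) →
                 (∀ x → x ∈ xs → P x) → Unique xs → Unique (map h xs)
Unique-map⁺-on {[]} _ _ [] = []
Unique-map⁺-on {x ∷ xs} inj Pxs (x∉xs ∷ u) =
  All.map⁺ (All.tabulate λ {y} y∈xs hx≡hy →
    All.lookup x∉xs y∈xs (inj (Pxs x (here refl)) (Pxs y (there y∈xs)) hx≡hy))
  ∷ Unique-map⁺-on inj (λ y → Pxs y ∘ there) u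

module Recolouring (S : ℤ → Set) (f g : ℤ → ℤ) (g∘f : ∀ x → S x → g (f x) ≡ x) where

  All-S : List ℤ → Set
  All-S xs = ∀ x → x ∈ xs → S x

  f-injective : ∀ {x y} → S x → S y → f x ≡ f y → x ≡ y
  f-injective {x} {y} Sx Sy fx≡fy = trans (sym (g∘f x Sx)) (trans (cong g fx≡fy) (g∘f y Sy))

  g-injective : ∀ {z z′} → All-S xs → All-S ys → z ∈ map f xs → z′ ∈ map f ys → g z ≡ g z′ → z ≡ z′
  g-injective Sxs Sys z∈ z′∈ gz≡gz′ with ∈-map⁻ f z∈ | ∈-map⁻ f z′∈
  ... | w , w∈ , refl | w′ , w′∈ , refl =
    cong f (trans (sym (g∘f w (Sxs w w∈))) (trans gz≡gz′ (g∘f w′ (Sys w′ w′∈))))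

  map-unique : All-S xs → Unique xs → Unique (map f xs)
  map-unique = Unique-map⁺-on f-injective

  ∈-map⁻-f : S x → All-S ys → f x ∈ map f ys → x ∈ ys
  ∈-map⁻-f {x} {ys} Sx Sys fx∈ with ∈-map⁻ f fx∈
  ... | y , y∈ys , fx≡fy = subst (_∈ ys) (sym (f-injective Sx (Sys y y∈ys) fx≡fy)) y∈ys

  interSize-map : All-S xs → All-S ys → interSize (map f xs) (map f ys) ≡ interSize xs ys
  interSize-map {[]} _ _ = refl
  interSize-map {x ∷ xs} {ys} Sxs Sys with f x ∈? map f ys | x ∈? ys
  ... | yes _ | yes _ = cong suc (interSize-map (λ y → Sxs y ∘ there) Sys)
  ... | no _ | no _ = interSize-map (λ y → Sxs y ∘ there) Sys
  ... | yes fx∈ | no x∉ = ⊥-elim (x∉ (∈-map⁻-f (Sxs x (here refl)) Sys fx∈))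
  ... | no fx∉ | yes x∈ = ⊥-elim (fx∉ (∈-map⁺ f x∈))

  pullback-⊆ : All-S xs → zs ⊆ map f xs → map g zs ⊆ xs
  pullback-⊆ {xs} Sxs zs⊆ x x∈ with ∈-map⁻ g x∈
  ... | z , z∈zs , refl with ∈-map⁻ f (zs⊆ z z∈zs)
  ... | w , w∈xs , refl = subst (_∈ xs) (sym (g∘f w (Sxs w w∈xs))) w∈xs

  pullback-⊇ : All-S xs → map f xs ⊆ zs → xs ⊆ map g zs
  pullback-⊇ {xs} {zs} Sxs ⊆zs x x∈xs =
    subst (_∈ map g zs) (g∘f x (Sxs x x∈xs)) (∈-map⁺ g (⊆zs (f x) (∈-map⁺ f x∈xs)))

  pullback-unique : All-S xs → zs ⊆ map f xs → Unique zs → Unique (map g zs)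
  pullback-unique Sxs zs⊆ = Unique-map⁺-on (λ z∈ z′∈ → g-injective Sxs Sxs z∈ z′∈) zs⊆

  pullback-colouring : ∀ G {b} {L L′ φ′ : Fin (n G) → List ℤ} →
    (∀ v → All-S (L v)) → (∀ v → L′ v ⊆ map f (L v)) →
    IsColoring G L′ b φ′ → IsColoring G L b (map g ∘ φ′)
  pullback-colouring G {b} {L} {L′} {φ′} SL L′⊆ (proper , disjoint) = vertex , edge
    where
    φ′⊆ : ∀ v → φ′ v ⊆ map f (L v)
    φ′⊆ v = ⊆-trans (proj₂ (proj₂ (proper v))) (L′⊆ v)
    vertex : ∀ v → Unique (map g (φ′ v)) × length (map g (φ′ v)) ≡ b × map g (φ′ v) ⊆ L v
    vertex v = pullback-unique (SL v) (φ′⊆ v) (proj₁ (proper v))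
             , trans (length-map g (φ′ v)) (proj₁ (proj₂ (proper v)))
             , pullback-⊆ (SL v) (φ′⊆ v)
    edge : ∀ u v → Adj G u v → ∀ x → x ∈ map g (φ′ u) → x ∈ map g (φ′ v) → ⊥
    edge u v u~v x x∈u x∈v with ∈-map⁻ g x∈u | ∈-map⁻ g x∈v
    ... | z , z∈u , refl | z′ , z′∈v , gz≡gz′ =
      disjoint u v u~v z z∈u
        (subst (_∈ φ′ v) (sym (g-injective (SL u) (SL v) (φ′⊆ u z z∈u) (φ′⊆ v z′ z′∈v) gz≡gz′)) z′∈v)

words : ℕ → List ℤ → List (List ℤ)
words zero X = [] ∷ []
words (suc k) X = concatMap (λ x → map (x ∷_) (words k X)) X

∈-words⁺ : ∀ {X} → length ys ≡ k → ys ⊆ X → ys ∈ words k X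
∈-words⁺ {[]} {zero} _ _ = here refl
∈-words⁺ {y ∷ ys} {suc k} {X} refl y∷ys⊆X =
  ∈-concat⁺′ (∈-map⁺ (y ∷_) (∈-words⁺ refl (λ z → y∷ys⊆X z ∘ there)))
             (∈-map⁺ (λ x → map (x ∷_) (words k X)) (y∷ys⊆X y (here refl)))

∈-words⁻ : ∀ {X} → ys ∈ words k X → length ys ≡ k × ys ⊆ X
∈-words⁻ {k = zero} (here refl) = refl , λ _ ()
∈-words⁻ {ys} {suc k} {X} ys∈ with ∈-concat⁻′ (map (λ x → map (x ∷_) (words k X)) X) ys∈
... | _ , ys∈x∷ , x∷∈ with ∈-map⁻ (λ x → map (x ∷_) (words k X)) x∷∈
... | x , x∈X , refl with ∈-map⁻ (x ∷_) ys∈x∷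
... | zs , zs∈ , refl with ∈-words⁻ {k = k} zs∈
... | ∣zs∣≡k , zs⊆X = cong suc ∣zs∣≡k , λ { _ (here refl) → x∈X ; z (there z∈zs) → zs⊆X z z∈zs }

module _ {A : Set} where

  _∷ᶠ_ : ∀ {m} → A → (Fin m → A) → Fin (suc m) → A
  (y ∷ᶠ f) zero = y
  (y ∷ᶠ f) (suc i) = f i

  choices : ∀ m → (Fin m → List A) → List (Fin m → A)
  choices zero _ = (λ ()) ∷ []
  choices (suc m) options =
    concatMap (λ y → map (y ∷ᶠ_) (choices m (options ∘ suc))) (options zero)

  ∈-choices⁺ : ∀ m options (f : Fin m → A) → (∀ i → f i ∈ options i) →
               ∃ λ g → g ∈ choices m options × (∀ i → g i ≡ f i)
  ∈-choices⁺ zero _ _ _ = (λ ()) , here refl , λ ()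
  ∈-choices⁺ (suc m) options f f∈ with ∈-choices⁺ m (options ∘ suc) (f ∘ suc) (f∈ ∘ suc)
  ... | g , g∈ , g≗f = (f zero ∷ᶠ g)
      , ∈-concat⁺′ (∈-map⁺ (f zero ∷ᶠ_) g∈)
                   (∈-map⁺ (λ y → map (y ∷ᶠ_) (choices m (options ∘ suc))) (f∈ zero))
      , λ { zero → refl ; (suc i) → g≗f i }

-- Colourings

take-⊆ : ∀ k xs → take k xs ⊆ xs
take-⊆ (suc k) (y ∷ xs) _ (here refl) = here refl
take-⊆ (suc k) (y ∷ xs) x (there x∈) = there (take-⊆ k xs x x∈)

take-subset : ∀ {b a} → b ≤ a → Unique xs × length xs ≡ a →
              Unique (take b xs) × length (take b xs) ≡ b × take b xs ⊆ xs
take-subset {xs} {b} b≤a (u , refl) =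
  Unique.take⁺ b u , trans (length-take b xs) (ℕ.m≤n⇒m⊓n≡m b≤a) , take-⊆ b xs

FreeChoosableAt : (G : Graph) → ℕ → ℕ → ℕ → Fin (n G) → Set
FreeChoosableAt G a b c v = ∀ (L : Fin (n G) → List ℤ) →
  ListAssignment G a L → Separating G c L →
  ∀ (C : List ℤ) → Unique C → length C ≡ b → C ⊆ L v →
  ∃ λ φ → IsColoring G L b φ × φ v ≐ C

IsColoring-≗ : ∀ {G b L φ ψ} → (∀ v → φ v ≡ ψ v) → IsColoring G L b φ → IsColoring G L b ψ
IsColoring-≗ {b = b} {L} φ≗ψ (proper , disjoint) =
  (λ v → subst (λ X → Unique X × length X ≡ b × X ⊆ L v) (φ≗ψ v) (proper v)) ,
  λ u v u~v x x∈u x∈v → disjoint u v u~v x (subst (x ∈_) (sym (φ≗ψ u)) x∈u) (subst (x ∈_) (sym (φ≗ψ v)) x∈v)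

module _ {G : Graph} {a b : ℕ} where

  freeChoosable⇒choosable : b ≤ a → Fin (n G) → ∀ {c} → FreeChoosable G a b c → Choosable G a b c
  freeChoosable⇒choosable b≤a v free L la sep =
    let (uC , ∣C∣≡b , C⊆) = take-subset b≤a (la v)
        (φ , colouring , _) = free L la sep v _ uC ∣C∣≡b C⊆
    in φ , colouring

  choosable-antitone : ∀ {c c′} → c′ ≤ c → Choosable G a b c → Choosable G a b c′
  choosable-antitone c′≤c choose L la sep = choose L la (λ u v u~v → ℕ.≤-trans (sep u v u~v) c′≤c)

  separating-a : ∀ {L} → ListAssignment G a L → Separating G a L
  separating-a {L} la u v _ = subst (interSize (L u) (L v) ≤_) (proj₂ (la u)) (interSize-≤ (L u) (L v))

  choosable-saturates : ∀ {c} → Choosable G a b a → Choosable G a b c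
  choosable-saturates choose L la _ = choose L la (separating-a la)

  -- on 0-separating lists any choice of b-subsets is proper
  freeChoosableAt-0 : b ≤ a → ∀ v → FreeChoosableAt G a b 0 v
  freeChoosableAt-0 b≤a v L la sep C uC ∣C∣≡b C⊆ = φ , (proper , disjoint) , φv≐C
    where
    φ : Fin (n G) → List ℤ
    φ u with u Fin.≟ v
    ... | yes _ = C
    ... | no _ = take b (L u)
    proper : ∀ u → Unique (φ u) × length (φ u) ≡ b × φ u ⊆ L u
    proper u with u Fin.≟ v
    ... | yes refl = uC , ∣C∣≡b , C⊆
    ... | no _ = take-subset b≤a (la u)
    disjoint : ∀ u w → Adj G u w → ∀ x → x ∈ φ u → x ∈ φ w → ⊥
    disjoint u w u~w x x∈u x∈w =
      interSize≤0⇒disjoint (sep u w u~w) (proj₂ (proj₂ (proper u)) x x∈u) (proj₂ (proj₂ (proper w)) x x∈w)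
    φv≐C : φ v ≐ C
    φv≐C with v Fin.≟ v
    ... | yes _ = ≐-refl
    ... | no v≢v = ⊥-elim (v≢v refl)

record Automorphism (G : Graph) : Set where
  field
    to from : Fin (n G) → Fin (n G)
    to-from : ∀ v → to (from v) ≡ v
    from-to : ∀ v → from (to v) ≡ v
    to-adj : ∀ {u v} → Adj G u v → Adj G (to u) (to v)
    from-adj : ∀ {u v} → Adj G u v → Adj G (from u) (from v)

freeChoosableAt-automorphism : ∀ {G a b c r} (σ : Automorphism G) →
  FreeChoosableAt G a b c r → FreeChoosableAt G a b c (Automorphism.to σ r)
freeChoosableAt-automorphism {G} {a} {b} {c} {r} σ free L la sep C uC ∣C∣≡b C⊆ =
  φ ∘ from , (proper , disjoint) , subst (λ v → φ v ≐ C) (sym (from-to r)) φr≐C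
  where
  open Automorphism σ
  extension : ∃ λ φ → IsColoring G (L ∘ to) b φ × φ r ≐ C
  extension = free (L ∘ to) (la ∘ to) (λ u v → sep (to u) (to v) ∘ to-adj) C uC ∣C∣≡b C⊆
  φ : Fin (n G) → List ℤ
  φ = proj₁ extension
  colouring : IsColoring G (L ∘ to) b φ
  colouring = proj₁ (proj₂ extension)
  φr≐C : φ r ≐ C
  φr≐C = proj₂ (proj₂ extension)
  proper : ∀ v → Unique (φ (from v)) × length (φ (from v)) ≡ b × φ (from v) ⊆ L v
  proper v = let (u , ∣φ∣≡b , φ⊆) = proj₁ colouring (from v)
             in u , ∣φ∣≡b , subst (λ w → φ (from v) ⊆ L w) (to-from v) φ⊆
  disjoint : ∀ u v → Adj G u v → ∀ x → x ∈ φ (from u) → x ∈ φ (from v) → ⊥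
  disjoint u v = proj₂ colouring (from u) (from v) ∘ from-adj

-- Deciding free choosability at a vertex

infix 4 _⊆?_
_⊆?_ : ∀ xs ys → Dec (xs ⊆ ys)
xs ⊆? ys = map′ (λ xs⊆ys x x∈ → xs⊆ys {x} x∈) (λ xs⊆ys {x} x∈ → xs⊆ys x x∈) (xs Subset.⊆? ys)

_≐?_ : ∀ xs ys → Dec (xs ≐ ys)
xs ≐? ys = xs ⊆? ys ×-dec ys ⊆? xs

disjoint? : ∀ xs ys → Dec (∀ x → x ∈ xs → x ∈ ys → ⊥)
disjoint? xs ys = map′ (λ xs∉ys x → All.lookup xs∉ys) (λ disjoint → All.tabulate (disjoint _))
                       (All.all? (λ x → ¬? (x ∈? ys)) xs)

module _ (G : Graph) (adj? : ∀ u v → Dec (Adj G u v)) where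

  isColoring? : ∀ L b φ → Dec (IsColoring G L b φ)
  isColoring? L b φ =
    Fin.all? (λ v → unique? (φ v) ×-dec length (φ v) ℕ.≟ b ×-dec φ v ⊆? L v) ×-dec
    Fin.all? (λ u → Fin.all? λ v → adj? u v →-dec disjoint? (φ u) (φ v))

  separating? : ∀ c L → Dec (Separating G c L)
  separating? c L = Fin.all? λ u → Fin.all? λ v → adj? u v →-dec interSize (L u) (L v) ℕ.≤? c

  listAssignment? : ∀ a L → Dec (ListAssignment G a L)
  listAssignment? a L = Fin.all? λ v → unique? (L v) ×-dec length (L v) ℕ.≟ a

allColours : ∀ m → (Fin m → List ℤ) → List ℤ
allColours zero _ = []
allColours (suc m) L = L zero ++ allColours m (L ∘ suc)

⊆-allColours : ∀ {m} L (v : Fin m) → L v ⊆ allColours m L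
⊆-allColours L zero _ = ∈-++⁺ˡ
⊆-allColours L (suc v) x x∈ = ∈-++⁺ʳ (L zero) (⊆-allColours (L ∘ suc) v x x∈)

length-allColours : ∀ m {a} L → (∀ v → length (L v) ≡ a) → length (allColours m L) ≡ m * a
length-allColours zero L _ = refl
length-allColours (suc m) L ∣L∣≡a =
  trans (length-++ (L zero)) (cong₂ ℕ._+_ (∣L∣≡a zero) (length-allColours m (L ∘ suc) (∣L∣≡a ∘ suc)))

-- Free choosability at r is invariant under injective recolouring, and every instance can be
-- recoloured so that L r becomes palette a, C becomes palette b and all colours lie in
-- palette N; this leaves finitely many instances to check.
module FreeChoosabilityDecision (G : Graph) (adj? : ∀ u v → Dec (Adj G u v)) (r : Fin (n G))
                                (a b : ℕ) where

  N : ℕ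
  N = n G * a

  Admissible : ℕ → (Fin (n G) → List ℤ) → Set
  Admissible c L = ListAssignment G a L × Separating G c L × L r ≐ palette a

  Extension : (Fin (n G) → List ℤ) → (Fin (n G) → List ℤ) → Set
  Extension L φ = IsColoring G L b φ × φ r ≐ palette b

  instances : List (Fin (n G) → List ℤ)
  instances = choices (n G) (λ _ → words a (palette N))

  candidates : (Fin (n G) → List ℤ) → List (Fin (n G) → List ℤ)
  candidates L = choices (n G) (λ v → words b (L v))

  CanonicallyFree : ℕ → Set
  CanonicallyFree c = All (λ L → Admissible c L → Any (Extension L) (candidates L)) instances

  admissible? : ∀ c L → Dec (Admissible c L)
  admissible? c L = listAssignment? G adj? a L ×-dec separating? G adj? c L ×-dec L r ≐? palette a

  extension? : ∀ L φ → Dec (Extension L φ)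
  extension? L φ = isColoring? G adj? L b φ ×-dec φ r ≐? palette b

  canonicallyFree? : ∀ c → Dec (CanonicallyFree c)
  canonicallyFree? c =
    All.all? (λ L → admissible? c L →-dec Any.any? (extension? L) (candidates L)) instances

  extension∈candidates : ∀ {L φ} → Extension L φ → Any (Extension L) (candidates L)
  extension∈candidates {L} {φ} (colouring , φr≐) with
    ∈-choices⁺ (n G) (λ v → words b (L v)) φ
      (λ v → let (_ , ∣φv∣≡b , φv⊆) = proj₁ colouring v in ∈-words⁺ ∣φv∣≡b φv⊆)
  ... | ψ , ψ∈ , ψ≗φ = Any.map (λ { refl → IsColoring-≗ {G} (sym ∘ ψ≗φ) colouring
                                         , subst (_≐ palette b) (sym (ψ≗φ r)) φr≐ }) ψ∈

  Obstruction : ℕ → Set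
  Obstruction c = ∃ λ L → Admissible c L × ¬ ∃ (Extension L)

  obstruction : ∀ {c} → ¬ CanonicallyFree c → Obstruction c
  obstruction {c} ¬free
    with find (¬All⇒Any¬ (λ L → admissible? c L →-dec Any.any? (extension? L) (candidates L)) instances ¬free)
  ... | L , _ , ¬extendable with admissible? c L
  ... | yes admissible = L , admissible , λ (_ , ext) → ¬extendable λ _ → extension∈candidates ext
  ... | no ¬admissible = ⊥-elim (¬extendable (⊥-elim ∘ ¬admissible))

  admissible-≗ : ∀ {c L L′} → (∀ v → L v ≡ L′ v) → Admissible c L → Admissible c L′
  admissible-≗ {c} L≗L′ (la , sep , Lr≐) =
    (λ v → subst (λ X → Unique X × length X ≡ a) (L≗L′ v) (la v)) ,
    (λ u v u~v → subst₂ (λ X Y → interSize X Y ≤ c) (L≗L′ u) (L≗L′ v) (sep u v u~v)) ,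
    subst (_≐ palette a) (L≗L′ r) Lr≐

  -- colour x is renamed to its position in W, which lists C first, then the rest of L r
  module Canonicalise {L : Fin (n G) → List ℤ} (la : ListAssignment G a L)
                      {C : List ℤ} (uC : Unique C) (∣C∣≡b : length C ≡ b) (C⊆Lr : C ⊆ L r) where

    W : List ℤ
    W = extend (extend C (L r)) (allColours (n G) L)

    ι : ℤ → ℤ
    ι x = + indexOf x W

    ρ : ℤ → ℤ
    ρ y = nth W ∣ y ∣

    open Recolouring (_∈ W) ι ρ (λ _ → nth-indexOf) public

    W-unique : Unique W
    W-unique = extend-unique (allColours (n G) L) (extend-unique (L r) uC)

    L⊆W : ∀ v → L v ⊆ W
    L⊆W v = ⊆-trans (⊆-allColours L v) (⊆-extendʳ (extend C (L r)))

    ∣W∣≤N : length W ≤ N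
    ∣W∣≤N = ℕ.≤-trans (Unique-⊆⇒length-≤ W-unique W⊆) (ℕ.≤-reflexive (length-allColours (n G) L (proj₂ ∘ la)))
      where
      W⊆ : W ⊆ allColours (n G) L
      W⊆ = extend-⊆ (extend-⊆ (⊆-trans C⊆Lr (⊆-allColours L r)) (⊆-allColours L r)) ⊆-refl

    indexOf-C : x ∈ C → indexOf x W < b
    indexOf-C {x} x∈C = subst (_< b) (sym (trans (indexOf-++ˡ (⊆-extendˡ (L r) x x∈C)) (indexOf-++ˡ x∈C)))
                          (subst (indexOf x C <_) ∣C∣≡b (indexOf-< x∈C))

    indexOf-Lr : x ∈ L r → indexOf x W < a
    indexOf-Lr {x} x∈Lr = begin-strict
      indexOf x W                 ≡⟨ indexOf-++ˡ x∈C+Lr ⟩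
      indexOf x (extend C (L r))  <⟨ indexOf-< x∈C+Lr ⟩
      length (extend C (L r))     ≤⟨ Unique-⊆⇒length-≤ (extend-unique (L r) uC) (extend-⊆ C⊆Lr ⊆-refl) ⟩
      length (L r)                ≡⟨ proj₂ (la r) ⟩
      a                           ∎
      where
      open ℕ.≤-Reasoning
      x∈C+Lr : x ∈ extend C (L r)
      x∈C+Lr = ⊆-extendʳ C x x∈Lr

    map-ι≐palette : ∀ {X} → X ⊆ W → Unique X → length X ≡ k → (∀ x → x ∈ X → indexOf x W < k) →
                    map ι X ≐ palette k
    map-ι≐palette {k} {X} X⊆W uX ∣X∣≡k index< = ⊆palette ,
      Unique-⊆-length-≤⇒⊇ (map-unique X⊆W uX) (palette-unique k) ⊆palette
        (ℕ.≤-reflexive (trans (length-palette k) (sym (trans (length-map ι X) ∣X∣≡k))))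
      where
      ⊆palette : map ι X ⊆ palette k
      ⊆palette y y∈ with ∈-map⁻ ι y∈
      ... | x , x∈X , refl = ∈-palette⁺ (index< x x∈X)

    canonical : Fin (n G) → List ℤ
    canonical = map ι ∘ L

    canonical∈words : ∀ v → canonical v ∈ words a (palette N)
    canonical∈words v = ∈-words⁺ (trans (length-map ι (L v)) (proj₂ (la v))) ⊆palette
      where
      ⊆palette : canonical v ⊆ palette N
      ⊆palette y y∈ with ∈-map⁻ ι y∈
      ... | x , x∈Lv , refl = ∈-palette⁺ (ℕ.<-≤-trans (indexOf-< (L⊆W v x x∈Lv)) ∣W∣≤N)

    canonical-admissible : ∀ {c} → Separating G c L → Admissible c canonical
    canonical-admissible {c} sep =
      (λ v → map-unique (L⊆W v) (proj₁ (la v)) , trans (length-map ι (L v)) (proj₂ (la v))) ,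
      (λ u v u~v → subst (_≤ c) (sym (interSize-map (L⊆W u) (L⊆W v))) (sep u v u~v)) ,
      map-ι≐palette (L⊆W r) (proj₁ (la r)) (proj₂ (la r)) (λ _ → indexOf-Lr)

    C-canonical : map ι C ≐ palette b
    C-canonical = map-ι≐palette (⊆-trans C⊆Lr (L⊆W r)) uC ∣C∣≡b (λ _ → indexOf-C)

  canonicallyFree⇒free : ∀ {c} → CanonicallyFree c → FreeChoosableAt G a b c r
  canonicallyFree⇒free {c} free L la sep C uC ∣C∣≡b C⊆Lr =
    map ρ ∘ φ′ , pullback-colouring G L⊆W L′⊆ colouring′ , φr⊆C , C⊆φr
    where
    open Canonicalise la uC ∣C∣≡b C⊆Lr
    L′-instance : ∃ λ L′ → L′ ∈ instances × (∀ v → L′ v ≡ canonical v)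
    L′-instance = ∈-choices⁺ (n G) (λ _ → words a (palette N)) canonical canonical∈words
    L′ : Fin (n G) → List ℤ
    L′ = proj₁ L′-instance
    L′⊆ : ∀ v → L′ v ⊆ map ι (L v)
    L′⊆ v x x∈ = subst (x ∈_) (proj₂ (proj₂ L′-instance) v) x∈
    extension : ∃ (Extension L′)
    extension = let (L′∈ , L′≗) = proj₂ L′-instance
                    (φ′ , _ , ext) = find (All.lookup free L′∈ (admissible-≗ (sym ∘ L′≗) (canonical-admissible sep)))
                in φ′ , ext
    φ′ : Fin (n G) → List ℤ
    φ′ = proj₁ extension
    colouring′ : IsColoring G L′ b φ′
    colouring′ = proj₁ (proj₂ extension)
    φ′r≐ : φ′ r ≐ palette b
    φ′r≐ = proj₂ (proj₂ extension)
    φr⊆C : map ρ (φ′ r) ⊆ C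
    φr⊆C = pullback-⊆ (⊆-trans C⊆Lr (L⊆W r)) (⊆-trans (proj₁ φ′r≐) (proj₂ C-canonical))
    C⊆φr : C ⊆ map ρ (φ′ r)
    C⊆φr = pullback-⊇ (⊆-trans C⊆Lr (L⊆W r)) (⊆-trans (proj₁ C-canonical) (proj₂ φ′r≐))

-- Cycles

_^_ : ∀ {A : Set} → (A → A) → ℕ → A → A
(f ^ zero) x = x
(f ^ suc k) x = f ((f ^ k) x)

module _ {A : Set} {f h : A → A} (commute : ∀ x → f (h x) ≡ h (f x)) where

  ^-commute : ∀ k x → (f ^ k) (h x) ≡ h ((f ^ k) x)
  ^-commute zero x = refl
  ^-commute (suc k) x = trans (cong f (^-commute k x)) (commute ((f ^ k) x))

^-inverse : ∀ {A : Set} {f g : A → A} → (∀ x → f (g x) ≡ x) → (∀ x → g (f x) ≡ x) →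
            ∀ k x → (f ^ k) ((g ^ k) x) ≡ x
^-inverse f∘g g∘f zero x = refl
^-inverse {f = f} {g} f∘g g∘f (suc k) x =
  trans (cong f (^-commute (λ y → trans (f∘g y) (sym (g∘f y))) k ((g ^ k) x)))
        (trans (f∘g _) (^-inverse f∘g g∘f k x))

module Cyclic {N : ℕ} where

  next : Fin (suc N) → Fin (suc N)
  next i with view i
  ... | ‵fromℕ = zero
  ... | ‵inj₁ {i = j} _ = suc j

  prev : Fin (suc N) → Fin (suc N)
  prev zero = fromℕ N
  prev (suc j) = inject₁ j

  next-fromℕ : next (fromℕ N) ≡ zero
  next-fromℕ rewrite view-fromℕ N = refl

  next-inject₁ : ∀ j → next (inject₁ j) ≡ suc j
  next-inject₁ j rewrite view-inject₁ j = refl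

  prev-next : ∀ i → prev (next i) ≡ i
  prev-next i with view i
  ... | ‵fromℕ = refl
  ... | ‵inj₁ _ = refl

  next-prev : ∀ i → next (prev i) ≡ i
  next-prev zero = next-fromℕ
  next-prev (suc j) = next-inject₁ j

  next≢id : 1 ≤ N → ∀ i → next i ≢ i
  next≢id 1≤N i with view i
  next≢id (s≤s _) i | ‵fromℕ = λ ()
  ... | ‵inj₁ {i = j} _ = λ e → ℕ.1+n≢n (trans (cong toℕ e) (Fin.toℕ-inject₁ j))

  next≢prev : 2 ≤ N → ∀ i → next i ≢ prev i
  next≢prev 2≤N i with view i
  next≢prev (s≤s (s≤s _)) i | ‵fromℕ = λ ()
  next≢prev (s≤s (s≤s _)) i | ‵inj₁ {i = zero} _ = λ ()
  ... | ‵inj₁ {i = suc j} _ = λ e → ℕ.m≢1+n+m (toℕ j) {1}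
    (sym (trans (cong toℕ e) (trans (Fin.toℕ-inject₁ (inject₁ j)) (Fin.toℕ-inject₁ j))))

open Cyclic

module _ (Q : ℕ) where

  CycleAdj : Fin (3 ℕ.+ Q) → Fin (3 ℕ.+ Q) → Set
  CycleAdj u v = v ≡ next u ⊎ u ≡ next v

  cycleGraph : Graph
  cycleGraph = record
    { n = 3 ℕ.+ Q
    ; Adj = CycleAdj
    ; sym = λ { (inj₁ e) → inj₂ e ; (inj₂ e) → inj₁ e }
    ; irrefl = λ { {v} (inj₁ e) → next≢id (s≤s z≤n) v (sym e) ; {v} (inj₂ e) → next≢id (s≤s z≤n) v (sym e) }
    }

  cycleAdj? : ∀ u v → Dec (CycleAdj u v)
  cycleAdj? u v = v Fin.≟ next u ⊎-dec u Fin.≟ next v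

  commutes⇒adj : ∀ {f} → (∀ x → f (next x) ≡ next (f x)) → ∀ {u v} → CycleAdj u v → CycleAdj (f u) (f v)
  commutes⇒adj {f} commute {u} (inj₁ v≡next-u) = inj₁ (trans (cong f v≡next-u) (commute u))
  commutes⇒adj {f} commute {v = v} (inj₂ u≡next-v) = inj₂ (trans (cong f u≡next-v) (commute v))

  rotation : ℕ → Automorphism cycleGraph
  rotation k = record
    { to = next ^ k
    ; from = prev ^ k
    ; to-from = ^-inverse next-prev prev-next k
    ; from-to = ^-inverse prev-next next-prev k
    ; to-adj = commutes⇒adj (^-commute (λ _ → refl) k)
    ; from-adj = commutes⇒adj (^-commute (λ x → trans (prev-next x) (sym (next-prev x))) k)
    }

  next^k-zero : ∀ k (k<p : k < 3 ℕ.+ Q) → (next ^ k) zero ≡ fromℕ< k<p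
  next^k-zero zero _ = refl
  next^k-zero (suc k) (s≤s k<) = begin
    next ((next ^ k) zero)            ≡⟨ cong next (next^k-zero k (ℕ.m≤n⇒m≤1+n k<)) ⟩
    next (fromℕ< (ℕ.m≤n⇒m≤1+n k<))    ≡⟨ cong next (Fin.toℕ-injective (trans (Fin.toℕ-fromℕ< _)
                                           (sym (trans (Fin.toℕ-inject₁ _) (Fin.toℕ-fromℕ< k<))))) ⟩
    next (inject₁ (fromℕ< k<))        ≡⟨ next-inject₁ (fromℕ< k<) ⟩
    suc (fromℕ< k<)                   ∎
    where open ≡-Reasoning

  freeChoosable-cycle : ∀ {a b c} → FreeChoosableAt cycleGraph a b c zero → FreeChoosable cycleGraph a b c
  freeChoosable-cycle {a} {b} {c} free L la sep v =
    subst (FreeChoosableAt cycleGraph a b c) zero↦v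
      (freeChoosableAt-automorphism (rotation (toℕ v)) free) L la sep
    where
    zero↦v : (next ^ toℕ v) zero ≡ v
    zero↦v = trans (next^k-zero (toℕ v) (Fin.toℕ<n v)) (Fin.fromℕ<-toℕ v (Fin.toℕ<n v))

distinct-pair-covers : ∀ {A : Set} {x₁ x₂ z₁ z₂ y : A} → x₁ ≢ x₂ →
                       (x₁ ≡ z₁ ⊎ x₁ ≡ z₂) → (x₂ ≡ z₁ ⊎ x₂ ≡ z₂) → (y ≡ z₁ ⊎ y ≡ z₂) → (y ≡ x₁ ⊎ y ≡ x₂)
distinct-pair-covers x₁≢x₂ (inj₁ refl) (inj₁ refl) _ = ⊥-elim (x₁≢x₂ refl)
distinct-pair-covers x₁≢x₂ (inj₂ refl) (inj₂ refl) _ = ⊥-elim (x₁≢x₂ refl)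
distinct-pair-covers _ (inj₁ refl) (inj₂ refl) y = y
distinct-pair-covers _ (inj₂ refl) (inj₁ refl) (inj₁ y≡z₁) = inj₂ y≡z₁
distinct-pair-covers _ (inj₂ refl) (inj₁ refl) (inj₂ y≡z₂) = inj₁ y≡z₂

no-three-in-two : ∀ {A : Set} {x₁ x₂ x₃ z₁ z₂ : A} → x₁ ≢ x₂ → x₁ ≢ x₃ → x₂ ≢ x₃ →
                  (x₁ ≡ z₁ ⊎ x₁ ≡ z₂) → (x₂ ≡ z₁ ⊎ x₂ ≡ z₂) → (x₃ ≡ z₁ ⊎ x₃ ≡ z₂) → ⊥
no-three-in-two x₁≢x₂ x₁≢x₃ x₂≢x₃ x₁∈ x₂∈ x₃∈ with distinct-pair-covers x₁≢x₂ x₁∈ x₂∈ x₃∈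
... | inj₁ refl = x₁≢x₃ refl
... | inj₂ refl = x₂≢x₃ refl

Fin-neighbour-closed : ∀ {m ℓ} (P : Fin (suc m) → Set ℓ) →
  (∀ j → P (inject₁ j) → P (suc j)) → (∀ j → P (suc j) → P (inject₁ j)) →
  ∀ {i} → P i → ∀ j → P j
Fin-neighbour-closed P up down {i} Pi =
  <-weakInduction P P0 up
  where
  P0 : P zero
  P0 = <-weakInduction (λ j → P j → P zero) (λ p → p) (λ j down-to-0 → down-to-0 ∘ down j) i Pi

module CycleNeighbours {G : Graph} (Cy : Cycle G) where

  vt : Fin (suc (m Cy)) → Fin (n G)
  vt = vert Cy

  consecutive : ∀ k → Adj G (vt k) (vt (next k))
  consecutive k with view k
  ... | ‵fromℕ = close Cy
  ... | ‵inj₁ {i = j} _ = adj Cy j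

  Neighbour : Fin (suc (m Cy)) → Fin (n G) → Set
  Neighbour k y = y ≡ vt (next k) ⊎ y ≡ vt (prev k)

  neighbour-adj : ∀ {k y} → Neighbour k y → Adj G (vt k) y
  neighbour-adj {k} (inj₁ refl) = consecutive k
  neighbour-adj {k} (inj₂ refl) = Graph.sym G (subst (Adj G (vt (prev k)) ∘ vt) (next-prev k) (consecutive (prev k)))

  neighbour-sym : ∀ {k l} → Neighbour k (vt l) → Neighbour l (vt k)
  neighbour-sym {k} (inj₁ e) = inj₂ (cong vt (trans (sym (prev-next k)) (cong prev (sym (inj Cy e)))))
  neighbour-sym {k} (inj₂ e) = inj₁ (cong vt (trans (sym (next-prev k)) (cong next (sym (inj Cy e)))))

  neighbours-distinct : ∀ k → vt (next k) ≢ vt (prev k)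
  neighbours-distinct k = next≢prev (long Cy) k ∘ inj Cy

  CycleEdge⇒ : ∀ {x y} → CycleEdge Cy x y → ∃ λ k → x ≡ vt k × Neighbour k y
  CycleEdge⇒ (inj₁ (inj₁ (j , refl , refl))) = inject₁ j , refl , inj₁ (cong vt (sym (next-inject₁ j)))
  CycleEdge⇒ (inj₁ (inj₂ (refl , refl))) = fromℕ _ , refl , inj₁ (cong vt (sym next-fromℕ))
  CycleEdge⇒ (inj₂ (inj₁ (j , refl , refl))) = suc j , refl , inj₂ refl
  CycleEdge⇒ (inj₂ (inj₂ (refl , refl))) = zero , refl , inj₂ refl

  Consec-next : ∀ k → Consec Cy (vt k) (vt (next k))
  Consec-next k with view k
  ... | ‵fromℕ = inj₂ (refl , refl)
  ... | ‵inj₁ {i = j} _ = inj₁ (j , refl , refl)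

  CycleEdge⇐ : ∀ {k y} → Neighbour k y → CycleEdge Cy (vt k) y
  CycleEdge⇐ {k} (inj₁ refl) = inj₁ (Consec-next k)
  CycleEdge⇐ {k} (inj₂ refl) = inj₂ (subst (λ l → Consec Cy (vt (prev k)) (vt l)) (next-prev k) (Consec-next (prev k)))

  CycleEdge-adj : ∀ {x y} → CycleEdge Cy x y → Adj G x y
  CycleEdge-adj e with CycleEdge⇒ e
  ... | _ , refl , y∈ = neighbour-adj y∈

  CycleEdge-sym : ∀ {x y} → CycleEdge Cy x y → CycleEdge Cy y x
  CycleEdge-sym (inj₁ c) = inj₂ c
  CycleEdge-sym (inj₂ c) = inj₁ c

  degree≤2⇒Neighbour : ∀ {k z₁ z₂} → (∀ y → Adj G (vt k) y → y ≡ z₁ ⊎ y ≡ z₂) →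
               ∀ y → Adj G (vt k) y → Neighbour k y
  degree≤2⇒Neighbour {k} ≤two y k~y = distinct-pair-covers (neighbours-distinct k)
    (≤two _ (neighbour-adj (inj₁ refl))) (≤two _ (neighbour-adj (inj₂ refl))) (≤two y k~y)

-- Flowers

Reach-trans : ∀ {G x y z} → Reach G x y → Reach G y z → Reach G x z
Reach-trans here y⇝z = y⇝z
Reach-trans (step x~w w⇝y) y⇝z = step x~w (Reach-trans w⇝y y⇝z)

Reach-sym : ∀ {G x y} → Reach G x y → Reach G y x
Reach-sym here = here
Reach-sym {G} (step x~w w⇝y) = Reach-trans (Reach-sym w⇝y) (step (Graph.sym G x~w) here)

-- flower Q K consists of K cycles of length 3 + Q sharing the vertex zero
module Flower (Q K : ℕ) where

  V : ℕ
  V = suc (K * suc (suc Q))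

  π : Fin K → Fin (3 ℕ.+ Q) → Fin V
  π i zero = zero
  π i (suc t) = suc (Fin.combine i t)

  π-injective : ∀ {i u w} → π i u ≡ π i w → u ≡ w
  π-injective {i} {zero} {zero} _ = refl
  π-injective {i} {suc t} {suc t′} e = cong suc (proj₂ (Fin.combine-injective i t i t′ (Fin.suc-injective e)))

  π-suc-injective : ∀ {i j t u} → π i (suc t) ≡ π j u → i ≡ j × suc t ≡ u
  π-suc-injective {i} {j} {t} {suc t′} e =
    let (i≡j , t≡t′) = Fin.combine-injective i t j t′ (Fin.suc-injective e) in i≡j , cong suc t≡t′

  RootOrPetal : Fin V → Set
  RootOrPetal x = x ≡ zero ⊎ ∃₂ λ i t → x ≡ π i (suc t)

  π-cases : ∀ x → RootOrPetal x
  π-cases zero = inj₁ refl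
  π-cases (suc y) with Fin.combine-surjective {K} {suc (suc Q)} y
  ... | i , t , e = inj₂ (i , t , cong suc (sym e))

  FlowerAdj : Fin V → Fin V → Set
  FlowerAdj x y = ∃ λ i → ∃₂ λ u w → x ≡ π i u × y ≡ π i w × CycleAdj Q u w

  flower : Graph
  flower = record
    { n = V
    ; Adj = FlowerAdj
    ; sym = λ (i , u , w , x≡ , y≡ , u~w) → i , w , u , y≡ , x≡ , Graph.sym (cycleGraph Q) u~w
    ; irrefl = λ (i , u , w , x≡ , x≡′ , u~w) →
        Graph.irrefl (cycleGraph Q) (subst (CycleAdj Q u) (sym (π-injective (trans (sym x≡) x≡′))) u~w)
    }

  π-adj : ∀ i {u w} → CycleAdj Q u w → FlowerAdj (π i u) (π i w)
  π-adj i u~w = i , _ , _ , refl , refl , u~w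

  nonroot-neighbours : ∀ i t y → FlowerAdj (π i (suc t)) y →
                       y ≡ π i (next (suc t)) ⊎ y ≡ π i (prev (suc t))
  nonroot-neighbours i t y (j , u , w , x≡ , refl , u~w) with π-suc-injective {i} {j} {t} {u} x≡
  ... | refl , refl with u~w
  ... | inj₁ w≡next = inj₁ (cong (π i) w≡next)
  ... | inj₂ u≡next = inj₂ (cong (π i) (trans (sym (prev-next w)) (cong prev (sym u≡next))))

  root~first : ∀ i → FlowerAdj (π i (suc zero)) zero
  root~first i = π-adj i (inj₂ (sym (next-inject₁ zero)))

  root~last : ∀ i → FlowerAdj (π i (fromℕ _)) zero
  root~last i = π-adj i (inj₁ (sym next-fromℕ))

  connected : Connected flower
  connected x y = Reach-trans (to-root x) (Reach-sym (to-root y))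
    where
    petal-to-root : ∀ i u → Reach flower (π i u) zero
    petal-to-root i = <-weakInduction (λ u → Reach flower (π i u) zero) here
      λ j j⇝0 → step (π-adj i (inj₂ (sym (next-inject₁ j)))) j⇝0
    to-root : ∀ x → Reach flower x zero
    to-root x with π-cases x
    ... | inj₁ refl = here
    ... | inj₂ (i , t , refl) = petal-to-root i (suc t)

  petalCycle : Fin K → Cycle flower
  petalCycle i = record
    { m = suc (suc Q)
    ; long = s≤s (s≤s z≤n)
    ; vert = π i
    ; inj = π-injective
    ; adj = λ j → π-adj i (inj₁ (sym (next-inject₁ j)))
    ; close = π-adj i (inj₁ (sym next-fromℕ))
    }

  module CycleInFlower (Cy : Cycle flower) where
    open CycleNeighbours Cy

    OnCycle : Fin V → Set
    OnCycle x = ∃ λ k → vt k ≡ x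

    nonroot-on-cycle : ∀ {k i t} → vt k ≡ π i (suc t) → ∀ y → FlowerAdj (vt k) y → Neighbour k y
    nonroot-on-cycle {i = i} {t} vk≡ =
      degree≤2⇒Neighbour λ y vk~y → nonroot-neighbours i t y (subst (λ x → FlowerAdj x y) vk≡ vk~y)

    neighbour-on-cycle : ∀ {i t y} → OnCycle (π i (suc t)) → FlowerAdj (π i (suc t)) y → OnCycle y
    neighbour-on-cycle (k , vk≡) x~y with nonroot-on-cycle vk≡ _ (subst (λ x → FlowerAdj x _) (sym vk≡) x~y)
    ... | inj₁ y≡ = next k , sym y≡
    ... | inj₂ y≡ = prev k , sym y≡

    petal⊆cycle : ∀ {i t₀} → OnCycle (π i (suc t₀)) → ∀ u → OnCycle (π i u)
    petal⊆cycle {i} on₀ zero = neighbour-on-cycle (petal⊆cycle on₀ (suc zero)) (root~first i)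
    petal⊆cycle {i} on₀ (suc t) = Fin-neighbour-closed (λ t → OnCycle (π i (suc t)))
      (λ j on → neighbour-on-cycle on (π-adj i (inj₁ (sym (next-inject₁ (suc j))))))
      (λ j on → neighbour-on-cycle on (π-adj i (inj₂ (sym (next-inject₁ (suc j)))))) on₀ t

    nonroot-vertex : ∃₂ λ i t → OnCycle (π i (suc t))
    nonroot-vertex with π-cases (vt zero) | π-cases (vt (next zero))
    ... | inj₂ (i , t , e) | _ = i , t , zero , e
    ... | inj₁ _ | inj₂ (i , t , e) = i , t , next zero , e
    ... | inj₁ v0≡0 | inj₁ v1≡0 =
      ⊥-elim (next≢id (ℕ.≤-trans (s≤s z≤n) (long Cy)) zero (inj Cy (trans v1≡0 (sym v0≡0))))

    petal : Fin K
    petal = proj₁ nonroot-vertex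

    petal-on-cycle : ∀ u → OnCycle (π petal u)
    petal-on-cycle = petal⊆cycle (proj₂ (proj₂ nonroot-vertex))

    length-≥ : 3 ℕ.+ Q ≤ suc (m Cy)
    length-≥ = Fin.injective⇒≤ {f = proj₁ ∘ petal-on-cycle} λ {u} {w} e →
      π-injective (trans (sym (proj₂ (petal-on-cycle u))) (trans (cong vt e) (proj₂ (petal-on-cycle w))))

    root : Fin (suc (m Cy))
    root = proj₁ (petal-on-cycle zero)

    root-neighbour : ∀ {i t} → OnCycle (π i (suc t)) → FlowerAdj (π i (suc t)) zero →
                     Neighbour root (π i (suc t))
    root-neighbour (k , vk≡) x~0 =
      subst (Neighbour root) vk≡ (neighbour-sym (subst (Neighbour k) (sym (proj₂ (petal-on-cycle zero)))
        (nonroot-on-cycle vk≡ zero (subst (λ x → FlowerAdj x zero) (sym vk≡) x~0))))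

    -- the root would otherwise have three neighbours on the cycle
    cycle⊆petal : ∀ k → vt k ≡ zero ⊎ ∃ λ t → vt k ≡ π petal (suc t)
    cycle⊆petal k with π-cases (vt k)
    ... | inj₁ vk≡0 = inj₁ vk≡0
    ... | inj₂ (j , t , vk≡) with j Fin.≟ petal
    ...   | yes refl = inj₂ (t , vk≡)
    ...   | no j≢petal = ⊥-elim (no-three-in-two
              (λ e → case π-injective e of λ ())
              (λ e → j≢petal (sym (proj₁ (π-suc-injective e))))
              (λ e → j≢petal (sym (proj₁ (π-suc-injective e))))
              (root-neighbour (petal-on-cycle (suc zero)) (root~first petal))
              (root-neighbour (petal-on-cycle (fromℕ _)) (root~last petal))
              (root-neighbour (petal⊆cycle (k , vk≡) (suc zero)) (root~first j)))

    petal-of : ∀ {k i t} → vt k ≡ π i (suc t) → i ≡ petal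
    petal-of {k} vk≡ with cycle⊆petal k
    ... | inj₁ vk≡0 = case trans (sym vk≡0) vk≡ of λ ()
    ... | inj₂ (t′ , vk≡′) = proj₁ (π-suc-injective (trans (sym vk≡) vk≡′))

  open CycleInFlower using (petal)

  nonroot-end : ∀ {x y} → FlowerAdj x y → (∃₂ λ i t → x ≡ π i (suc t)) ⊎ (∃₂ λ i t → y ≡ π i (suc t))
  nonroot-end {x} {y} x~y with π-cases x | π-cases y
  ... | inj₂ x-nonroot | _ = inj₁ x-nonroot
  ... | inj₁ _ | inj₂ y-nonroot = inj₂ y-nonroot
  ... | inj₁ refl | inj₁ refl = ⊥-elim (Graph.irrefl flower x~y)

  edge-petal : ∀ C {x y i t} → CycleEdge C x y → x ≡ π i (suc t) → i ≡ petal C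
  edge-petal C e x≡ with CycleNeighbours.CycleEdge⇒ C e
  ... | k , refl , _ = CycleInFlower.petal-of C x≡

  edge-transfer : ∀ C D {x y i t} → petal C ≡ petal D → CycleEdge C x y → x ≡ π i (suc t) → CycleEdge D x y
  edge-transfer C D {y = y} {t = t} same e x≡ with trans (edge-petal C e x≡) same
  ... | refl with CycleInFlower.petal-on-cycle D (suc t)
  ... | l , vl≡ = subst (λ x → CycleEdge D x y) (trans vl≡ (sym x≡))
        (CycleNeighbours.CycleEdge⇐ D (CycleInFlower.nonroot-on-cycle D vl≡ y
          (subst (λ x → FlowerAdj x y) (trans x≡ (sym vl≡)) (CycleNeighbours.CycleEdge-adj C e))))

  same-petal⇒same-edges : ∀ C D → petal C ≡ petal D → ∀ {x y} → CycleEdge C x y → CycleEdge D x y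
  same-petal⇒same-edges C D same e with nonroot-end (CycleNeighbours.CycleEdge-adj C e)
  ... | inj₁ (_ , _ , x≡) = edge-transfer C D same e x≡
  ... | inj₂ (_ , _ , y≡) = CycleNeighbours.CycleEdge-sym D
                              (edge-transfer C D same (CycleNeighbours.CycleEdge-sym C e) y≡)

  shared-edge⇒same-petal : ∀ C D {x y} → CycleEdge C x y → CycleEdge D x y → petal C ≡ petal D
  shared-edge⇒same-petal C D eC eD with nonroot-end (CycleNeighbours.CycleEdge-adj C eC)
  ... | inj₁ (_ , _ , x≡) = trans (sym (edge-petal C eC x≡)) (edge-petal D eD x≡)
  ... | inj₂ (_ , _ , y≡) = trans (sym (edge-petal C (CycleNeighbours.CycleEdge-sym C eC) y≡))
                                  (edge-petal D (CycleNeighbours.CycleEdge-sym D eD) y≡)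

  cactus : Cactus flower
  cactus = connected , λ C D _ _ _ eC eD _ _ →
    let same = shared-edge⇒same-petal C D eC eD
    in same-petal⇒same-edges C D same , same-petal⇒same-edges D C (sym same)

  girth : Fin K → Girth flower (3 ℕ.+ Q)
  girth i = (petalCycle i , refl) , CycleInFlower.length-≥

  caseOnPetals : ∀ {A : Set} {y} → A → (Fin K → Fin (2 ℕ.+ Q) → A) → RootOrPetal y → A
  caseOnPetals r _ (inj₁ _) = r
  caseOnPetals _ h (inj₂ (i , t , _)) = h i t

  onPetals : ∀ {A : Set} → A → (Fin K → Fin (2 ℕ.+ Q) → A) → Fin V → A
  onPetals r h y = caseOnPetals r h (π-cases y)

  onPetals-π : ∀ {A : Set} (r : A) h i t → onPetals r h (π i (suc t)) ≡ h i t
  onPetals-π r h i t = by-cases (π-cases (π i (suc t)))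
    where
    by-cases : (d : RootOrPetal (π i (suc t))) → caseOnPetals r h d ≡ h i t
    by-cases (inj₁ ())
    by-cases (inj₂ (j , t′ , e)) with π-suc-injective (sym e)
    ... | refl , refl = refl

  module Glue {b : ℕ} (L : Fin V → List ℤ) {R : List ℤ} (R-proper : Unique R × length R ≡ b × R ⊆ L zero)
              (extension : ∀ i → ∃ λ ψ → IsColoring (cycleGraph Q) (L ∘ π i) b ψ × ψ zero ≐ R) where

    ψ : Fin K → Fin (3 ℕ.+ Q) → List ℤ
    ψ i = proj₁ (extension i)

    glued : Fin V → List ℤ
    glued = onPetals R (λ i t → ψ i (suc t))

    glued-π : ∀ i u → glued (π i u) ≐ ψ i u
    glued-π i zero = ≐-sym (proj₂ (proj₂ (extension i)))
    glued-π i (suc t) = subst (_≐ ψ i (suc t)) (sym (onPetals-π R (λ i t → ψ i (suc t)) i t)) ≐-refl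

    glued-colouring : IsColoring flower L b glued
    glued-colouring = proper , disjoint
      where
      proper : ∀ y → Unique (glued y) × length (glued y) ≡ b × glued y ⊆ L y
      proper y with π-cases y
      ... | inj₁ refl = R-proper
      ... | inj₂ (i , t , refl) = proj₁ (proj₁ (proj₂ (extension i))) (suc t)
      disjoint : ∀ y z → FlowerAdj y z → ∀ x → x ∈ glued y → x ∈ glued z → ⊥
      disjoint _ _ (i , u , w , refl , refl , u~w) x x∈u x∈w =
        proj₂ (proj₁ (proj₂ (extension i))) u w u~w x (proj₁ (glued-π i u) x x∈u) (proj₁ (glued-π i w) x x∈w)

  free-on-petal : ∀ {a b c} → FreeChoosable (cycleGraph Q) a b c →
    ∀ {L} → ListAssignment flower a L → Separating flower c L →
    ∀ i u D → Unique D → length D ≡ b → D ⊆ L (π i u) →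
    ∃ λ ψ → IsColoring (cycleGraph Q) (L ∘ π i) b ψ × ψ u ≐ D
  free-on-petal free {L} la sep i = free (L ∘ π i) (la ∘ π i) (λ u w → sep (π i u) (π i w) ∘ π-adj i)

  freeChoosable-flower : ∀ {a b c} → FreeChoosable (cycleGraph Q) a b c → FreeChoosable flower a b c
  freeChoosable-flower {a} {b} {c} free L la sep x C uC ∣C∣≡b C⊆ with π-cases x
  ... | inj₁ refl = glued , glued-colouring , ≐-refl
    where
    open Glue L (uC , ∣C∣≡b , C⊆) (λ i → free-on-petal free la sep i zero C uC ∣C∣≡b C⊆)
  ... | inj₂ (i₀ , t₀ , refl) = glued , glued-colouring ,
        ≐-trans (glued-π i₀ (suc t₀)) (proj₂ (proj₂ (proj₂ (extension i₀))) refl)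
    where
    extension₀ : ∃ λ φ → IsColoring (cycleGraph Q) (L ∘ π i₀) b φ × φ (suc t₀) ≐ C
    extension₀ = free-on-petal free la sep i₀ (suc t₀) C uC ∣C∣≡b C⊆
    R : List ℤ
    R = proj₁ extension₀ zero
    R-proper : Unique R × length R ≡ b × R ⊆ L zero
    R-proper = proj₁ (proj₁ (proj₂ extension₀)) zero
    extension : ∀ i → ∃ λ ψ → IsColoring (cycleGraph Q) (L ∘ π i) b ψ × ψ zero ≐ R × (i ≡ i₀ → ψ (suc t₀) ≐ C)
    extension i with i Fin.≟ i₀
    ... | yes refl = let (φ₀ , colouring₀ , φ₀≐C) = extension₀ in φ₀ , colouring₀ , ≐-refl , λ _ → φ₀≐C
    ... | no i≢i₀ = let (uR , ∣R∣≡b , R⊆) = R-proper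
                        (ψ , colouring , ψ0≐R) = free-on-petal free la sep i zero R uR ∣R∣≡b R⊆
                    in ψ , colouring , ψ0≐R , ⊥-elim ∘ i≢i₀
    open Glue L R-proper (λ i → proj₁ (extension i) , proj₁ (proj₂ (extension i)) ,
                                proj₁ (proj₂ (proj₂ (extension i))))

module _ {P : ℕ → Set} (P? : ∀ c → Dec (P c)) (antitone : ∀ {c c′} → c′ ≤ c → P c → P c′) where

  threshold : P 0 → ∀ k → ¬ P k → ∃ λ s → P s × ¬ P (suc s)
  threshold P0 zero ¬P0 = ⊥-elim (¬P0 P0)
  threshold P0 (suc k) ¬Pk+1 with P? k
  ... | yes Pk = k , Pk , ¬Pk+1
  ... | no ¬Pk = threshold P0 k ¬Pk

  ∃IsMax-antitone : P 0 → ∀ a → (P a → ∀ c → P c) → ∃ (IsMax P)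
  ∃IsMax-antitone P0 a saturate with P? a
  ... | yes Pa = nothing , saturate Pa
  ... | no ¬Pa = let (s , Ps , ¬Ps+1) = threshold P0 a ¬Pa
                 in just s , Ps , λ c Pc → ℕ.≮⇒≥ λ s<c → ¬Ps+1 (antitone s<c Pc)

IsMax-⇔ : ∀ {P P′ : ℕ → Set} → (∀ c → P c → P′ c) → (∀ c → P′ c → P c) → ∀ s → IsMax P s → IsMax P′ s
IsMax-⇔ P⇒P′ P′⇒P (just s) (Ps , max) = P⇒P′ s Ps , λ c → max c ∘ P′⇒P c
IsMax-⇔ P⇒P′ P′⇒P nothing all = λ c → P⇒P′ c (all c)

orderings : ℕ → List (List ℤ)
orderings k = filter unique? (words k (palette k))

∈-orderings⁺ : Unique xs → length xs ≡ k → xs ⊆ palette k → xs ∈ orderings k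
∈-orderings⁺ u ∣xs∣≡k xs⊆ = ∈-filter⁺ unique? (∈-words⁺ ∣xs∣≡k xs⊆) u

∈-orderings⁻ : xs ∈ orderings k → Unique xs × length xs ≡ k × xs ≐ palette k
∈-orderings⁻ {xs} {k} xs∈ with ∈-filter⁻ unique? {xs = words k (palette k)} xs∈
... | xs∈words , u with ∈-words⁻ {k = k} xs∈words
... | ∣xs∣≡k , xs⊆ = u , ∣xs∣≡k , xs⊆ ,
  Unique-⊆-length-≤⇒⊇ u (palette-unique k) xs⊆ (ℕ.≤-reflexive (trans (length-palette k) (sym ∣xs∣≡k)))

extend-∈-orderings : Unique xs → xs ⊆ palette k → extend xs (palette k) ∈ orderings k
extend-∈-orderings {xs} {k} u xs⊆ = ∈-orderings⁺ ω-unique (ℕ.≤-antisym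
  (ℕ.≤-trans (Unique-⊆⇒length-≤ ω-unique ω⊆) (ℕ.≤-reflexive (length-palette k)))
  (ℕ.≤-trans (ℕ.≤-reflexive (sym (length-palette k))) (Unique-⊆⇒length-≤ (palette-unique k) (⊆-extendʳ xs)))) ω⊆
  where
  ω-unique : Unique (extend xs (palette k))
  ω-unique = extend-unique (palette k) u
  ω⊆ : extend xs (palette k) ⊆ palette k
  ω⊆ = extend-⊆ xs⊆ ⊆-refl

module OrderingFlower (Q a b : ℕ) (b≤a : b ≤ a) where

  K : ℕ
  K = length (orderings a)

  open Flower Q K
  open FreeChoosabilityDecision (cycleGraph Q) (cycleAdj? Q) zero a b
    using (Obstruction; CanonicallyFree; canonicallyFree?; canonicallyFree⇒free; obstruction)

  ordering : Fin K → List ℤ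
  ordering e = lookup (orderings a) e

  ordering-valid : ∀ e → Unique (ordering e) × length (ordering e) ≡ a × ordering e ≐ palette a
  ordering-valid e = ∈-orderings⁻ (∈-lookup e)

  relabel unrelabel : Fin K → ℤ → ℤ
  relabel e = reindex (palette a) (ordering e)
  unrelabel e = reindex (ordering e) (palette a)

  unrelabel-relabel : ∀ e x → unrelabel e (relabel e x) ≡ x
  unrelabel-relabel e = let (u , ∣ω∣≡a , ω≐) = ordering-valid e in
    reindex-inverse u (trans (length-palette a) (sym ∣ω∣≡a)) (≐-sym ω≐)

  relabel-unrelabel : ∀ e x → relabel e (unrelabel e x) ≡ x
  relabel-unrelabel e = let (_ , ∣ω∣≡a , ω≐) = ordering-valid e in
    reindex-inverse (palette-unique a) (trans ∣ω∣≡a (sym (length-palette a))) ω≐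

  module Relabel (e : Fin K) = Recolouring (λ _ → ⊤) (relabel e) (unrelabel e) (λ x _ → unrelabel-relabel e x)

  relabel-palette : ∀ e → map (relabel e) (palette a) ≐ palette a
  relabel-palette e = let (_ , ∣ω∣≡a , ω≐) = ordering-valid e in
    ≐-trans (map-reindex (palette-unique a) (trans (length-palette a) (sym ∣ω∣≡a))) ω≐

  module Lift {c} {L : Fin (3 ℕ.+ Q) → List ℤ} (la : ListAssignment (cycleGraph Q) a L)
              (sep : Separating (cycleGraph Q) c L) (L0≐ : L zero ≐ palette a) where

    lifted : Fin V → List ℤ
    lifted = onPetals (palette a) (λ e t → map (relabel e) (L (suc t)))

    lifted-π : ∀ e u → lifted (π e u) ≐ map (relabel e) (L u)
    lifted-π e zero = ≐-sym (≐-trans (map-≐ (relabel e) L0≐) (relabel-palette e))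
    lifted-π e (suc t) = subst (_≐ map (relabel e) (L (suc t)))
                               (sym (onPetals-π (palette a) (λ e t → map (relabel e) (L (suc t))) e t)) ≐-refl

    relabelled-la : ∀ e u → Unique (map (relabel e) (L u)) × length (map (relabel e) (L u)) ≡ a
    relabelled-la e u = Relabel.map-unique e (λ _ _ → tt) (proj₁ (la u)) , trans (length-map _ (L u)) (proj₂ (la u))

    lifted-la : ListAssignment flower a lifted
    lifted-la y with π-cases y
    ... | inj₁ refl = palette-unique a , length-palette a
    ... | inj₂ (e , t , refl) = relabelled-la e (suc t)

    lifted-sep : Separating flower c lifted
    lifted-sep _ _ (e , u , w , refl , refl , u~w) = subst (_≤ c) (sym (begin
      interSize (lifted (π e u)) (lifted (π e w))
        ≡⟨ interSize-≐ (proj₁ (lifted-la (π e u))) (proj₁ (relabelled-la e u)) (lifted-π e u) (lifted-π e w) ⟩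
      interSize (map (relabel e) (L u)) (map (relabel e) (L w))
        ≡⟨ Relabel.interSize-map e {L u} {L w} (λ _ _ → tt) (λ _ _ → tt) ⟩
      interSize (L u) (L w) ∎)) (sep u w u~w)
      where open ≡-Reasoning

  map-unrelabel-prefix : ∀ e {D} → ordering e ≡ extend D (palette a) → Unique D → length D ≡ b →
                         map (unrelabel e) D ≐ palette b
  map-unrelabel-prefix e {D} ordering≡ uD ∣D∣≡b = ⊆palette , Unique-⊆-length-≤⇒⊇
    (Unique.map⁺ (λ {x} {y} e≡ → trans (sym (relabel-unrelabel e x))
                                  (trans (cong (relabel e) e≡) (relabel-unrelabel e y))) uD)
    (palette-unique b) ⊆palette
    (ℕ.≤-reflexive (trans (length-palette b) (sym (trans (length-map _ D) ∣D∣≡b))))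
    where
    index<b : ∀ {x} → x ∈ D → indexOf x D < b
    index<b x∈D = subst (_ <_) ∣D∣≡b (indexOf-< x∈D)
    unrelabel-D : ∀ {x} → x ∈ D → unrelabel e x ≡ + indexOf x D
    unrelabel-D {x} x∈D = begin
      reindex (ordering e) (palette a) x          ≡⟨ cong (λ ω → reindex ω (palette a) x) ordering≡ ⟩
      reindex (extend D (palette a)) (palette a) x
        ≡⟨ reindex-∈ {xs = extend D (palette a)} (⊆-extendˡ (palette a) x x∈D) ⟩
      nth (palette a) (indexOf x (extend D (palette a))) ≡⟨ cong (nth (palette a)) (indexOf-++ˡ x∈D) ⟩
      nth (palette a) (indexOf x D)                ≡⟨ nth-palette (ℕ.<-≤-trans (index<b x∈D) b≤a) ⟩
      + indexOf x D                                ∎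
      where open ≡-Reasoning
    ⊆palette : map (unrelabel e) D ⊆ palette b
    ⊆palette y y∈ with ∈-map⁻ (unrelabel e) y∈
    ... | x , x∈D , refl = subst (_∈ palette b) (sym (unrelabel-D x∈D)) (∈-palette⁺ (index<b x∈D))

  obstruction⇒¬choosable : ∀ {c} → Obstruction c → ¬ Choosable flower a b c
  obstruction⇒¬choosable (L , (la , sep , L0≐) , ¬extension) choose = ¬extension (φ′ , colouring′ , φ′0≐)
    where
    open Lift la sep L0≐
    φ : Fin V → List ℤ
    φ = proj₁ (choose lifted lifted-la lifted-sep)
    colouring : IsColoring flower lifted b φ
    colouring = proj₂ (choose lifted lifted-la lifted-sep)
    D-proper : Unique (φ zero) × length (φ zero) ≡ b × φ zero ⊆ palette a
    D-proper = proj₁ colouring zero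
    ω∈ : extend (φ zero) (palette a) ∈ orderings a
    ω∈ = extend-∈-orderings (proj₁ D-proper) (proj₂ (proj₂ D-proper))
    e : Fin K
    e = Any.index ω∈
    φ′ : Fin (3 ℕ.+ Q) → List ℤ
    φ′ u = map (unrelabel e) (φ (π e u))
    colouring′ : IsColoring (cycleGraph Q) L b φ′
    colouring′ = Relabel.pullback-colouring e (cycleGraph Q) (λ _ _ _ → tt) (λ u → proj₁ (lifted-π e u))
                   (proj₁ colouring ∘ π e , λ u w → proj₂ colouring (π e u) (π e w) ∘ π-adj e)
    φ′0≐ : φ′ zero ≐ palette b
    φ′0≐ = map-unrelabel-prefix e (sym (lookup-index ω∈)) (proj₁ D-proper) (proj₁ (proj₂ D-proper))

  palette∈orderings : palette a ∈ orderings a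
  palette∈orderings = ∈-orderings⁺ (palette-unique a) (length-palette a) ⊆-refl

  canonicallyFree⇒freeChoosable : ∀ {c} → CanonicallyFree c → FreeChoosable flower a b c
  canonicallyFree⇒freeChoosable = freeChoosable-flower ∘ freeChoosable-cycle Q ∘ canonicallyFree⇒free

  choosable⇒canonicallyFree : ∀ {c} → Choosable flower a b c → CanonicallyFree c
  choosable⇒canonicallyFree {c} choose with canonicallyFree? c
  ... | yes free = free
  ... | no ¬free = ⊥-elim (obstruction⇒¬choosable (obstruction ¬free) choose)

  choosable⇒freeChoosable : ∀ c → Choosable flower a b c → FreeChoosable flower a b c
  choosable⇒freeChoosable c = canonicallyFree⇒freeChoosable ∘ choosable⇒canonicallyFree

  free⇒choosable : ∀ c → FreeChoosable flower a b c → Choosable flower a b c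
  free⇒choosable c = freeChoosable⇒choosable {flower} b≤a zero

  choosable? : ∀ c → Dec (Choosable flower a b c)
  choosable? c = map′ (free⇒choosable c ∘ canonicallyFree⇒freeChoosable) choosable⇒canonicallyFree
                      (canonicallyFree? c)

  sep≡fsep : ∃ λ s → IsMax (Choosable flower a b) s × IsMax (FreeChoosable flower a b) s
  sep≡fsep =
    let (s , max) = ∃IsMax-antitone choosable? (choosable-antitone {flower})
                      (free⇒choosable 0 λ L la sep v → freeChoosableAt-0 {flower} b≤a v L la sep)
                      a (λ choose-a _ → choosable-saturates {flower} choose-a)
    in s , max , IsMax-⇔ choosable⇒freeChoosable free⇒choosable s max

proposition6 : ∀ (a b p : ℕ) → b ≤ a → 1 ≤ b → 3 ≤ p →
    ∃ λ (G : Graph) → Cactus G × Girth G p ×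
      ∃ λ (s : Maybe ℕ) →
        IsMax (Choosable G a b) s × IsMax (FreeChoosable G a b) s
-- the argument does not need b ≥ 1
proposition6 a b (suc (suc (suc Q))) b≤a _ (s≤s (s≤s (s≤s _))) =
  flower , cactus , girth (Any.index palette∈orderings) , sep≡fsep
  where
  open OrderingFlower Q a b b≤a
  open Flower Q K
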